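{- Let $G$ be a graph of order $n$ with $m$ edges and degree sequence $d_1\le d_2\le\cdots\le d_n$. Let $p_1(G):=\max\{i \mid d_i\le n-i\}$ and $p(G):=\lfloor\frac{1}{2}+\sqrt{\frac{1}{4}+n^2-n-2m}\rfloor$. Then $\alpha(G)\le p_1(G)\le p(G)$.
   Context: Graphs are finite and simple. $\alpha(G)$ denotes the independence number of $G$. Note $p_1(G)$ is well defined since $d_1\le n-1$. -}

module Defs where

open import Data.Bool using (Bool; true; false; _∧_; not; if_then_else_; T?)
open import Data.Nat using (ℕ; zero; suc; _+_; _*_; _∸_; _≤_; _<_; _≤ᵇ_; _<ᵇ_; _⊔_)
open import Data.Nat.Properties using (≤-decTotalOrder)
open import Data.Fin using (Fin; toℕ)
open import Data.Fin.Subset using (Subset; ∣_∣)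
open import Data.Vec using (Vec; []; _∷_; lookup)
open import Data.List using (List; []; _∷_; map; _++_; allFin; length; filter; foldr)
open import Data.Nat.ListAction using (sum)
open import Data.Bool.ListAction using (and)
open import Data.List.Sort ≤-decTotalOrder using (sort)
open import Data.Product using (_×_)
open import Relation.Binary.PropositionalEquality using (_≡_)

record Graph (n : ℕ) : Set where
  field
    adj    : Fin n → Fin n → Bool
    sym    : ∀ u v → adj u v ≡ adj v u
    irrefl : ∀ v → adj v v ≡ false
open Graph public

countᵇ : {A : Set} → (A → Bool) → List A → ℕ
countᵇ p xs = length (filter (λ x → T? (p x)) xs)

deg : ∀ {n} → Graph n → Fin n → ℕ
deg {n} G v = countᵇ (adj G v) (allFin n)

edges : ∀ {n} → Graph n → ℕ
edges {n} G = sum (map (λ u → countᵇ (λ v → (toℕ u <ᵇ toℕ v) ∧ adj G u v) (allFin n)) (allFin n))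

degSeq : ∀ {n} → Graph n → List ℕ
degSeq {n} G = sort (map (deg G) (allFin n))

nth : List ℕ → ℕ → ℕ
nth []       _       = 0
nth (x ∷ xs) zero    = x
nth (x ∷ xs) (suc i) = nth xs i

-- d_i (1-based)
d : ∀ {n} → Graph n → ℕ → ℕ
d G i = nth (degSeq G) (i ∸ 1)

oneTo : ℕ → List ℕ
oneTo zero    = []
oneTo (suc n) = oneTo n ++ (suc n ∷ [])

maximum : List ℕ → ℕ
maximum = foldr _⊔_ 0

-- p₁(G) = max { i ∈ {1..n} | d_i ≤ n - i }  (0 if the set is empty, i.e. n = 0)
p₁ : ∀ {n} → Graph n → ℕ
p₁ {n} G = maximum (map (λ i → if d G i ≤ᵇ (n ∸ i) then i else 0) (oneTo n))

allSubsets : ∀ n → List (Subset n)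
allSubsets zero    = [] ∷ []
allSubsets (suc n) = map (true ∷_) (allSubsets n) ++ map (false ∷_) (allSubsets n)

independentᵇ : ∀ {n} → Graph n → Subset n → Bool
independentᵇ {n} G S =
  and (map (λ u → and (map (λ v → not (lookup S u ∧ lookup S v ∧ adj G u v)) (allFin n))) (allFin n))

α : ∀ {n} → Graph n → ℕ
α {n} G = maximum (map ∣_∣ (filter (λ S → T? (independentᵇ G S)) (allSubsets n)))

-- Dm = n² - n - 2m  (≥ 0 for a simple graph)
Dm : ∀ {n} → Graph n → ℕ
Dm {n} G = n * n ∸ n ∸ 2 * edges G

-- k = ⌊ 1/2 + √(1/4 + D) ⌋, i.e. k ≤ 1/2 + √(1/4+D) < k + 1; multiplying by 2:
--   2k - 1 ≤ √(1 + 4D)  (automatic if 2k - 1 < 0, else square)  and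
--   √(1 + 4D) < 2k + 1  (square; both sides nonnegative)
IsFloorP : ℕ → ℕ → Set
IsFloorP D k = ((2 * k ∸ 1) * (2 * k ∸ 1) ≤ 1 + 4 * D) × (1 + 4 * D < (2 * k + 1) * (2 * k + 1))

IsP : ∀ {n} → Graph n → ℕ → Set
IsP G k = IsFloorP (Dm G) k

-- Part 1: the neighbours of a vertex of an independent set S lie outside S, so
-- at least |S| vertices have degree at most n − |S|; in the sorted degree
-- sequence this says d_|S| ≤ n − |S|, so |S| ≤ p₁.
-- Part 2: if k = p₁ ≥ 1, so that d_k ≤ n − k, then bounding the k smallest degrees by n − k and
-- the others by n − 1 gives 2m ≤ k(n − k) + (n − k)(n − 1), which rearranges
-- to n² − n − 2m ≥ k(k − 1). Hence (2k − 1)² ≤ 1 + 4(n² − n − 2m) < (2p + 1)²,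
-- and so k ≤ p.
module Submission where

open import Defs
open import Data.Bool.Base using (Bool; true; false; T; _∧_; not; if_then_else_)
open import Data.Bool.Properties using (T?)
open import Data.Empty using (⊥-elim)
open import Data.Fin.Base as Fin using (Fin; toℕ)
open import Data.Fin.Properties using (toℕ-injective)
open import Data.Fin.Subset using (Subset; ∣_∣; ⁅_⁆)
open import Data.Fin.Subset.Properties using (∣p∣≤n; ∣⁅x⁆∣≡1; x∈⁅y⁆⇒x≡y)
open import Data.List.Base using (List; []; _∷_; map; allFin; length)
open import Data.List.Membership.Propositional using (_∈_)
open import Data.List.Membership.Propositional.Properties using (∈-allFin; ∈-map⁺; ∈-++⁺ˡ; ∈-++⁺ʳ)
open import Data.List.Properties using (map-tabulate; length-tabulate; map-∘; length-map; map-cong)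
open import Data.List.Relation.Binary.Permutation.Propositional using (_↭_; ↭-sym)
import Data.List.Relation.Binary.Permutation.Propositional.Properties as Perm
open import Data.List.Relation.Unary.All as All using (All; []; _∷_)
import Data.List.Relation.Unary.All.Properties as All
open import Data.List.Relation.Unary.AllPairs using (AllPairs; _∷_)
open import Data.List.Relation.Unary.Any using (here; there)
open import Data.List.Relation.Unary.Linked.Properties using (Linked⇒AllPairs)
open import Data.Nat.Base using (ℕ; zero; suc; _+_; _*_; _∸_; _≤_; _<_; _≤ᵇ_; _<ᵇ_; z≤n; s≤s; s≤s⁻¹)
open import Data.Nat.ListAction using (sum)
open import Data.Nat.ListAction.Properties using (sum-↭)
open import Data.Nat.Properties
open import Data.Nat.Tactic.RingSolver using (solve-∀)
open import Data.List.Sort ≤-decTotalOrder using (sort-↭; sort-↗)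
open import Data.Product using (_×_; _,_)
open import Data.Sum using (_⊎_; inj₁; inj₂)
open import Data.Unit using (tt)
open import Data.Vec.Base using ([]; _∷_; lookup)
open import Data.Vec.Properties using (lookup⇒[]=)
open import Function using (id; _∘_)
open import Relation.Binary.PropositionalEquality
  using (_≡_; refl; cong; cong₂; subst; subst₂; module ≡-Reasoning)
  renaming (sym to ≡-sym; trans to ≡-trans)
open import Relation.Nullary using (yes; no)

private
  variable
    A B : Set
    n : ℕ

𝕀 : Bool → ℕ
𝕀 true  = 1
𝕀 false = 0

𝕀≤1 : ∀ b → 𝕀 b ≤ 1
𝕀≤1 true  = s≤s z≤n
𝕀≤1 false = z≤n

∑ : List A → (A → ℕ) → ℕ
∑ xs f = sum (map f xs)

syntax ∑ xs (λ x → e) = ∑[ x ∈ xs ] e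

∑-cong : ∀ (xs : List A) {f g : A → ℕ} → (∀ x → f x ≡ g x) → ∑ xs f ≡ ∑ xs g
∑-cong xs f≗g = cong sum (map-cong f≗g xs)

∑-mono-≤ : ∀ (xs : List A) {f g : A → ℕ} → (∀ x → f x ≤ g x) → ∑ xs f ≤ ∑ xs g
∑-mono-≤ []       f≤g = z≤n
∑-mono-≤ (x ∷ xs) f≤g = +-mono-≤ (f≤g x) (∑-mono-≤ xs f≤g)

∑-distrib-+ : ∀ (xs : List A) (f g : A → ℕ) → ∑[ x ∈ xs ] (f x + g x) ≡ ∑ xs f + ∑ xs g
∑-distrib-+ []       f g = refl
∑-distrib-+ (x ∷ xs) f g rewrite ∑-distrib-+ xs f g = interchange (f x) (g x) (∑ xs f) (∑ xs g)
  where
  interchange : ∀ a b c d → a + b + (c + d) ≡ a + c + (b + d)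
  interchange = solve-∀

∑-zero : ∀ (xs : List A) → ∑[ x ∈ xs ] 0 ≡ 0
∑-zero []       = refl
∑-zero (x ∷ xs) = ∑-zero xs

∑-one : ∀ (xs : List A) → ∑[ x ∈ xs ] 1 ≡ length xs
∑-one []       = refl
∑-one (x ∷ xs) = cong suc (∑-one xs)

∑-comm : ∀ (xs : List A) (ys : List B) (h : A → B → ℕ) →
         ∑[ x ∈ xs ] ∑[ y ∈ ys ] h x y ≡ ∑[ y ∈ ys ] ∑[ x ∈ xs ] h x y
∑-comm []       ys h = ≡-sym (∑-zero ys)
∑-comm (x ∷ xs) ys h = ≡-trans (cong (∑ ys (h x) +_) (∑-comm xs ys h))
  (≡-sym (∑-distrib-+ ys (h x) (λ y → ∑[ x ∈ xs ] h x y)))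

∑-↭ : ∀ (f : A → ℕ) {xs ys} → xs ↭ ys → ∑ xs f ≡ ∑ ys f
∑-↭ f xs↭ys = sum-↭ (Perm.map⁺ f xs↭ys)

∑-allFin-suc : ∀ (f : Fin (suc n) → ℕ) →
               ∑ (allFin (suc n)) f ≡ f Fin.zero + ∑ (allFin n) (f ∘ Fin.suc)
∑-allFin-suc f = cong (f Fin.zero +_)
  (cong sum (≡-trans (map-tabulate Fin.suc f) (≡-sym (map-tabulate id (f ∘ Fin.suc)))))

∑-allFin-one : ∑[ v ∈ allFin n ] 1 ≡ n
∑-allFin-one {n} = ≡-trans (∑-one (allFin n)) (length-tabulate id)

countᵇ-∑ : ∀ (p : A → Bool) xs → countᵇ p xs ≡ ∑[ x ∈ xs ] 𝕀 (p x)
countᵇ-∑ p []       = refl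
countᵇ-∑ p (x ∷ xs) with p x
... | true  = cong suc (countᵇ-∑ p xs)
... | false = countᵇ-∑ p xs

∣∣-∑ : ∀ (S : Subset n) → ∣ S ∣ ≡ ∑[ v ∈ allFin n ] 𝕀 (lookup S v)
∣∣-∑ {zero}  []      = refl
∣∣-∑ {suc n} (b ∷ S) = ≡-trans (lemma b) (≡-sym (∑-allFin-suc (𝕀 ∘ lookup (b ∷ S))))
  where
  lemma : ∀ b → ∣ b ∷ S ∣ ≡ 𝕀 b + ∑[ v ∈ allFin n ] 𝕀 (lookup S v)
  lemma true  = cong suc (∣∣-∑ S)
  lemma false = ∣∣-∑ S

deg-∑ : ∀ (G : Graph n) u → deg G u ≡ ∑[ v ∈ allFin n ] 𝕀 (adj G u v)
deg-∑ {n} G u = countᵇ-∑ (adj G u) (allFin n)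

deg+∣∣≤n : ∀ (G : Graph n) u (S : Subset n) →
           (∀ v → lookup S v ≡ true → adj G u v ≡ false) → deg G u + ∣ S ∣ ≤ n
deg+∣∣≤n {n} G u S nonadj = begin
  deg G u + ∣ S ∣                                               ≡⟨ cong₂ _+_ (deg-∑ G u) (∣∣-∑ S) ⟩
  ∑[ v ∈ allFin n ] 𝕀 (adj G u v) + ∑[ v ∈ allFin n ] 𝕀 (lookup S v) ≡⟨ ∑-distrib-+ (allFin n) _ _ ⟨
  ∑[ v ∈ allFin n ] (𝕀 (adj G u v) + 𝕀 (lookup S v))            ≤⟨ ∑-mono-≤ (allFin n) disjoint ⟩
  ∑[ v ∈ allFin n ] 1                                            ≡⟨ ∑-allFin-one ⟩
  n                                                              ∎
  where
  open ≤-Reasoning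
  disjoint : ∀ v → 𝕀 (adj G u v) + 𝕀 (lookup S v) ≤ 1
  disjoint v with lookup S v in v∈S
  ... | true  rewrite nonadj v v∈S = ≤-refl
  ... | false = ≤-trans (≤-reflexive (+-identityʳ _)) (𝕀≤1 (adj G u v))

deg<n : ∀ (G : Graph n) u → deg G u < n
deg<n {n} G u = subst (_≤ n) (≡-trans (cong (deg G u +_) (∣⁅x⁆∣≡1 u)) (+-comm (deg G u) 1))
  (deg+∣∣≤n G u ⁅ u ⁆ λ v v∈⁅u⁆ →
    subst (λ w → adj G u w ≡ false) (≡-sym (x∈⁅y⁆⇒x≡y u (lookup⇒[]= v ⁅ u ⁆ v∈⁅u⁆))) (irrefl G u))

module _ (G : Graph n) where

  edgeFrom : Fin n → Fin n → ℕ
  edgeFrom u v = 𝕀 ((toℕ u <ᵇ toℕ v) ∧ adj G u v)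

  adj-split : ∀ u v → 𝕀 (adj G u v) ≡ edgeFrom u v + edgeFrom v u
  adj-split u v with toℕ u <ᵇ toℕ v in u<v | toℕ v <ᵇ toℕ u in v<u
  ... | true  | true  = ⊥-elim (<-asym (<ᵇ⇒< (toℕ u) (toℕ v) (subst T (≡-sym u<v) tt))
                                      (<ᵇ⇒< (toℕ v) (toℕ u) (subst T (≡-sym v<u) tt)))
  ... | true  | false = ≡-sym (+-identityʳ _)
  ... | false | true  = cong 𝕀 (Graph.sym G u v)
  ... | false | false = cong 𝕀 (subst (λ w → adj G u w ≡ false) u≡v (irrefl G u))
    where
    u≡v : u ≡ v
    u≡v = toℕ-injective (≤-antisym (≮⇒≥ (λ p → subst T v<u (<⇒<ᵇ p))) (≮⇒≥ (λ p → subst T u<v (<⇒<ᵇ p))))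

  handshake : ∑ (allFin n) (deg G) ≡ 2 * edges G
  handshake = begin
    ∑ (allFin n) (deg G)
      ≡⟨ ∑-cong (allFin n) (λ u → ≡-trans (deg-∑ G u) (∑-cong (allFin n) (adj-split u))) ⟩
    ∑[ u ∈ allFin n ] ∑[ v ∈ allFin n ] (edgeFrom u v + edgeFrom v u)
      ≡⟨ ∑-cong (allFin n) (λ u → ∑-distrib-+ (allFin n) (edgeFrom u) (λ v → edgeFrom v u)) ⟩
    ∑[ u ∈ allFin n ] (∑ (allFin n) (edgeFrom u) + ∑[ v ∈ allFin n ] edgeFrom v u)
      ≡⟨ ∑-distrib-+ (allFin n) _ _ ⟩
    m + ∑[ u ∈ allFin n ] ∑[ v ∈ allFin n ] edgeFrom v u
      ≡⟨ cong (m +_) (∑-comm (allFin n) (allFin n) (λ u v → edgeFrom v u)) ⟩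
    m + m
      ≡⟨ cong (λ t → t + t) m≡edges ⟩
    edges G + edges G
      ≡⟨ cong (edges G +_) (+-identityʳ (edges G)) ⟨
    2 * edges G ∎
    where
    open ≡-Reasoning
    m = ∑[ u ∈ allFin n ] ∑ (allFin n) (edgeFrom u)
    m≡edges : m ≡ edges G
    m≡edges = ≡-sym (∑-cong (allFin n) (λ u → countᵇ-∑ (λ v → (toℕ u <ᵇ toℕ v) ∧ adj G u v) (allFin n)))

nth-All : ∀ {P : ℕ → Set} xs j → All P xs → j < length xs → P (nth xs j)
nth-All (x ∷ xs) zero    (px ∷ _)   _         = px
nth-All (x ∷ xs) (suc j) (_  ∷ pxs) (s≤s j<∣xs∣) = nth-All xs j pxs j<∣xs∣

𝕀-≤ᵇ-< : ∀ {c y} → c < y → 𝕀 (y ≤ᵇ c) ≡ 0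
𝕀-≤ᵇ-< {c} {y} c<y with y ≤ᵇ c in y≤c
... | false = refl
... | true  = ⊥-elim (<⇒≱ c<y (≤ᵇ⇒≤ y c (subst T (≡-sym y≤c) tt)))

𝕀-≤ᵇ-≤ : ∀ {c y} → y ≤ c → 𝕀 (y ≤ᵇ c) ≡ 1
𝕀-≤ᵇ-≤ {c} {y} y≤c with y ≤ᵇ c in y≤ᵇc
... | true  = refl
... | false = ⊥-elim (subst T y≤ᵇc (≤⇒≤ᵇ y≤c))

count-≤ᵇ-above : ∀ c ys → All (c <_) ys → ∑[ y ∈ ys ] 𝕀 (y ≤ᵇ c) ≡ 0
count-≤ᵇ-above c []       []         = refl
count-≤ᵇ-above c (y ∷ ys) (c<y ∷ cs) rewrite 𝕀-≤ᵇ-< c<y = count-≤ᵇ-above c ys cs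

count-≤ᵇ-sorted : ∀ c xs j → AllPairs _≤_ xs → c < nth xs j → ∑[ y ∈ xs ] 𝕀 (y ≤ᵇ c) ≤ j
count-≤ᵇ-sorted c (x ∷ xs) zero    (x≤xs ∷ _) c<x =
  ≤-reflexive (count-≤ᵇ-above c (x ∷ xs) (c<x ∷ All.map (<-≤-trans c<x) x≤xs))
count-≤ᵇ-sorted c (x ∷ xs) (suc j) (_ ∷ sorted) c<xⱼ =
  +-mono-≤ (𝕀≤1 (x ≤ᵇ c)) (count-≤ᵇ-sorted c xs j sorted c<xⱼ)

sum≤length*bound : ∀ B xs → All (_≤ B) xs → sum xs ≤ length xs * B
sum≤length*bound B []       []         = z≤n
sum≤length*bound B (x ∷ xs) (x≤B ∷ bs) = +-mono-≤ x≤B (sum≤length*bound B xs bs)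

sum-sorted-≤ : ∀ B c xs j → AllPairs _≤_ xs → All (_≤ B) xs → nth xs j ≤ c → j < length xs →
               sum xs ≤ suc j * c + (length xs ∸ suc j) * B
sum-sorted-≤ B c (x ∷ xs) zero (_ ∷ _) (_ ∷ bs) x≤c _ =
  +-mono-≤ (≤-trans x≤c (≤-reflexive (≡-sym (+-identityʳ c)))) (sum≤length*bound B xs bs)
sum-sorted-≤ B c (x ∷ xs) (suc j) (x≤xs ∷ sorted) (_ ∷ bs) xⱼ≤c (s≤s j<∣xs∣) =
  ≤-trans (+-mono-≤ (≤-trans (nth-All xs j x≤xs j<∣xs∣) xⱼ≤c) (sum-sorted-≤ B c xs j sorted bs xⱼ≤c j<∣xs∣))
          (≤-reflexive (≡-sym (+-assoc c (suc j * c) ((length xs ∸ suc j) * B))))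

module DegreeSequence (G : Graph n) where

  degSeq↭ : degSeq G ↭ map (deg G) (allFin n)
  degSeq↭ = sort-↭ _

  degSeq-sorted : AllPairs _≤_ (degSeq G)
  degSeq-sorted = Linked⇒AllPairs ≤-trans (sort-↗ _)

  length-degSeq : length (degSeq G) ≡ n
  length-degSeq = ≡-trans (Perm.↭-length degSeq↭) (≡-trans (length-map (deg G) (allFin n)) (length-tabulate id))

  sum-degSeq : sum (degSeq G) ≡ 2 * edges G
  sum-degSeq = ≡-trans (sum-↭ degSeq↭) (handshake G)

  degSeq-bounded : All (_≤ n ∸ 1) (degSeq G)
  degSeq-bounded = Perm.All-resp-↭ (↭-sym degSeq↭)
    (All.map⁺ (All.universal (λ u → ∸-monoˡ-≤ 1 (deg<n G u)) (allFin n)))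

  ∑-degSeq : ∀ (g : ℕ → ℕ) → ∑ (degSeq G) g ≡ ∑[ u ∈ allFin n ] g (deg G u)
  ∑-degSeq g = ≡-trans (∑-↭ g degSeq↭) (cong sum (≡-sym (map-∘ (allFin n))))

  d≤-counting : ∀ {j c} → suc j ≤ ∑[ u ∈ allFin n ] 𝕀 (deg G u ≤ᵇ c) → d G (suc j) ≤ c
  d≤-counting {j} {c} many = ≮⇒≥ λ c<dⱼ → <-irrefl refl (≤-trans many
    (subst (_≤ j) (∑-degSeq (λ y → 𝕀 (y ≤ᵇ c))) (count-≤ᵇ-sorted c (degSeq G) j degSeq-sorted c<dⱼ)))

  twice-edges≤ : ∀ {k} → suc k ≤ n → d G (suc k) ≤ n ∸ suc k →
                 2 * edges G ≤ suc k * (n ∸ suc k) + (n ∸ suc k) * (n ∸ 1)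
  twice-edges≤ {k} k<n dₖ≤ =
    subst₂ _≤_ sum-degSeq (cong (λ ℓ → suc k * (n ∸ suc k) + (ℓ ∸ suc k) * (n ∸ 1)) length-degSeq)
    (sum-sorted-≤ (n ∸ 1) (n ∸ suc k) (degSeq G) k degSeq-sorted degSeq-bounded dₖ≤
      (subst (k <_) (≡-sym length-degSeq) k<n))

≤-maximum : ∀ {x} xs → x ∈ xs → x ≤ maximum xs
≤-maximum (y ∷ ys) (here refl)  = m≤m⊔n y (maximum ys)
≤-maximum (y ∷ ys) (there x∈ys) = ≤-trans (≤-maximum ys x∈ys) (m≤n⊔m y (maximum ys))

maximum-≤ : ∀ {b} xs → All (_≤ b) xs → maximum xs ≤ b
maximum-≤ []       []         = z≤n
maximum-≤ (x ∷ xs) (x≤b ∷ bs) = ⊔-lub x≤b (maximum-≤ xs bs)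

maximum-preserves : ∀ {P : ℕ → Set} xs → P 0 → All P xs → P (maximum xs)
maximum-preserves []           p0 []         = p0
maximum-preserves {P} (x ∷ xs) p0 (px ∷ pxs) with ⊔-sel x (maximum xs)
... | inj₁ ≡x = subst P (≡-sym ≡x) px
... | inj₂ ≡m = subst P (≡-sym ≡m) (maximum-preserves xs p0 pxs)

∈-oneTo : ∀ {i} n → 1 ≤ i → i ≤ n → i ∈ oneTo n
∈-oneTo zero    (s≤s z≤n) ()
∈-oneTo {i} (suc n) 1≤i i≤1+n with i ≟ suc n
... | yes refl = ∈-++⁺ʳ (oneTo n) (here refl)
... | no  i≢1+n = ∈-++⁺ˡ (∈-oneTo n 1≤i (s≤s⁻¹ (≤∧≢⇒< i≤1+n i≢1+n)))

oneTo-bounded : ∀ n → All (λ i → 1 ≤ i × i ≤ n) (oneTo n)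
oneTo-bounded zero    = []
oneTo-bounded (suc n) =
  All.++⁺ (All.map (λ (1≤i , i≤n) → 1≤i , m≤n⇒m≤1+n i≤n) (oneTo-bounded n)) ((s≤s z≤n , ≤-refl) ∷ [])

Admissible : Graph n → ℕ → Set
Admissible {n} G i = 1 ≤ i × i ≤ n × d G i ≤ n ∸ i

module _ (G : Graph n) where

  candidate : ℕ → ℕ
  candidate i = if d G i ≤ᵇ (n ∸ i) then i else 0

  admissible⇒≤p₁ : ∀ {i} → Admissible G i → i ≤ p₁ G
  admissible⇒≤p₁ {i} (1≤i , i≤n , dᵢ≤) =
    ≤-maximum (map candidate (oneTo n)) (subst (_∈ map candidate (oneTo n)) candidate≡i
      (∈-map⁺ candidate (∈-oneTo n 1≤i i≤n)))
    where
    candidate≡i : candidate i ≡ i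
    candidate≡i with d G i ≤ᵇ (n ∸ i) in dᵢ≤ᵇ
    ... | true  = refl
    ... | false = ⊥-elim (subst T dᵢ≤ᵇ (≤⇒≤ᵇ dᵢ≤))

  p₁-admissible : p₁ G ≡ 0 ⊎ Admissible G (p₁ G)
  p₁-admissible = maximum-preserves {λ j → j ≡ 0 ⊎ Admissible G j} (map candidate (oneTo n)) (inj₁ refl)
    (All.map⁺ (All.map candidate-admissible (oneTo-bounded n)))
    where
    candidate-admissible : ∀ {i} → 1 ≤ i × i ≤ n → candidate i ≡ 0 ⊎ Admissible G (candidate i)
    candidate-admissible {i} (1≤i , i≤n) with d G i ≤ᵇ (n ∸ i) in dᵢ≤
    ... | true  = inj₂ (1≤i , i≤n , ≤ᵇ⇒≤ (d G i) (n ∸ i) (subst T (≡-sym dᵢ≤) tt))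
    ... | false = inj₁ refl

square-cancel-< : ∀ {a b} → a * a < b * b → a < b
square-cancel-< {a} {b} a²<b² = ≰⇒> λ b≤a → <⇒≱ a²<b² (*-mono-≤ b≤a b≤a)

[n²-n]-split : ∀ k r → (1 + k + r) * (1 + k + r) ∸ (1 + k + r) ≡ (1 + k) * k + ((1 + k) * r + r * (k + r))
[n²-n]-split k r = ≡-trans (m+n∸m≡n (1 + k + r) ((k + r) * (1 + k + r))) (ring k r)
  where
  ring : ∀ k r → (k + r) * (1 + k + r) ≡ (1 + k) * k + ((1 + k) * r + r * (k + r))
  ring = solve-∀

pronic≤Dm : ∀ {k n E} → suc k ≤ n → 2 * E ≤ suc k * (n ∸ suc k) + (n ∸ suc k) * (n ∸ 1) →
            suc k * k ≤ n * n ∸ n ∸ 2 * E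
pronic≤Dm {k} {E = E} k<n 2E≤ with m≤n⇒∃[o]m+o≡n k<n
... | r , refl rewrite m+n∸m≡n (suc k) r | [n²-n]-split k r = begin
  suc k * k                   ≡⟨ m+n∸n≡m (suc k * k) X ⟨
  suc k * k + X ∸ X           ≤⟨ ∸-monoʳ-≤ (suc k * k + X) 2E≤ ⟩
  suc k * k + X ∸ 2 * E       ∎
  where
  open ≤-Reasoning
  X = suc k * r + r * (k + r)

pronic≤D⇒≤p : ∀ {k D p} → suc k * k ≤ D → 1 + 4 * D < (2 * p + 1) * (2 * p + 1) → suc k ≤ p
pronic≤D⇒≤p {k} {D} {p} k[k+1]≤D upper =
  *-cancelˡ-< 2 k p (+-cancelʳ-< 1 (2 * k) (2 * p) (square-cancel-< (begin-strict
  (2 * k + 1) * (2 * k + 1) ≡⟨ odd-square k ⟩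
  1 + 4 * (suc k * k)       ≤⟨ +-monoʳ-≤ 1 (*-monoʳ-≤ 4 k[k+1]≤D) ⟩
  1 + 4 * D                 <⟨ upper ⟩
  (2 * p + 1) * (2 * p + 1) ∎)))
  where
  open ≤-Reasoning
  odd-square : ∀ k → (2 * k + 1) * (2 * k + 1) ≡ 1 + 4 * ((1 + k) * k)
  odd-square = solve-∀

module _ (G : Graph n) where
  open DegreeSequence G

  independent⇒nonadjacent : ∀ S → T (independentᵇ G S) → ∀ {u v} →
                            lookup S u ≡ true → lookup S v ≡ true → adj G u v ≡ false
  independent⇒nonadjacent S indep {u} {v} u∈S v∈S = nonadjacent (adj G u v)
    (subst₂ (λ a b → T (not (a ∧ b ∧ adj G u v))) u∈S v∈S
      (All.lookup (All.all⁺ _ (allFin n) (All.lookup (All.all⁺ _ (allFin n) indep) (∈-allFin u))) (∈-allFin v)))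
    where
    nonadjacent : ∀ a → T (not (true ∧ true ∧ a)) → a ≡ false
    nonadjacent false _ = refl

  independent⇒admissible : ∀ S {a} → T (independentᵇ G S) → ∣ S ∣ ≡ suc a → Admissible G (suc a)
  independent⇒admissible S {a} indep ∣S∣≡ = s≤s z≤n , a<n , d≤-counting (begin
    suc a                                        ≡⟨ ≡-trans (≡-sym ∣S∣≡) (∣∣-∑ S) ⟩
    ∑[ u ∈ allFin n ] 𝕀 (lookup S u)             ≤⟨ ∑-mono-≤ (allFin n) member⇒low ⟩
    ∑[ u ∈ allFin n ] 𝕀 (deg G u ≤ᵇ n ∸ suc a)   ∎)
    where
    open ≤-Reasoning
    a<n : suc a ≤ n
    a<n = subst (_≤ n) ∣S∣≡ (∣p∣≤n S)
    member⇒low : ∀ u → 𝕀 (lookup S u) ≤ 𝕀 (deg G u ≤ᵇ n ∸ suc a)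
    member⇒low u with lookup S u in u∈S
    ... | false = z≤n
    ... | true  = ≤-reflexive (≡-sym (𝕀-≤ᵇ-≤ (m+n≤o⇒m≤o∸n (deg G u)
                    (subst (λ s → deg G u + s ≤ n) ∣S∣≡
                      (deg+∣∣≤n G u S (λ v v∈S → independent⇒nonadjacent S indep u∈S v∈S))))))

  independent-size≤p₁ : ∀ S → T (independentᵇ G S) → ∣ S ∣ ≤ p₁ G
  independent-size≤p₁ S indep with ∣ S ∣ in ∣S∣≡
  ... | zero  = z≤n
  ... | suc a = admissible⇒≤p₁ G (independent⇒admissible S indep ∣S∣≡)

  α≤p₁ : α G ≤ p₁ G
  α≤p₁ = maximum-≤ _ (All.map⁺ (All.map (λ {S} → independent-size≤p₁ S)
    (All.all-filter (λ S → T? (independentᵇ G S)) (allSubsets n))))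

  admissible⇒≤p : ∀ {k p} → Admissible G k → IsP G p → k ≤ p
  admissible⇒≤p (s≤s z≤n , k≤n , dₖ≤) (_ , upper) =
    pronic≤D⇒≤p (pronic≤Dm {E = edges G} k≤n (twice-edges≤ k≤n dₖ≤)) upper

  p₁≤p : ∀ {p} → IsP G p → p₁ G ≤ p
  p₁≤p isP with p₁-admissible G
  ... | inj₁ p₁≡0 = subst (_≤ _) (≡-sym p₁≡0) z≤n
  ... | inj₂ adm  = admissible⇒≤p adm isP

proposition2 : ∀ (n : ℕ) (G : Graph n) (p : ℕ) → IsP G p → (α G ≤ p₁ G) × (p₁ G ≤ p)
proposition2 n G p isP = α≤p₁ G , p₁≤p G isP
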